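{- For every ribbon graph (embedded graph) $G$ there exist a partition $E(G)=A_1\cup\dots\cup A_6$ (parts possibly empty) such that the twisted dual $G^{\prod_{i=1}^6 \xi_i(A_i)}$ is checkerboard colourable, where $\xi_1,\dots,\xi_6$ are the six elements of $\mathcal{B}=\langle \delta,\tau\mid \delta^2,\tau^2,(\delta\tau)^3\rangle$. In other words, every embedded graph has a checkerboard colourable twisted dual.
   Context: A ribbon graph $G$ is a (possibly non-orientable) surface with boundary, written as a union of vertex discs $V(G)$ and edge discs $E(G)$, such that vertices and edges meet in disjoint line segments, each such segment lies on the boundary of exactly one vertex and one edge, and every edge contains exactly two such segments. Ribbon graphs are equivalent to cellularly embedded graphs; the faces are the boundary components of the ribbon graph. For an edge $e$, deleting its two vertex–edge intersection segments from $\partial e$ leaves two arcs (the edge line segments of $e$), each lying on a boundary component. $G$ is checkerboard colourable if the faces (boundary components) can be coloured red/blue so that for every edge, the faces containing its two edge line segments receive different colours. For $A\subseteq E(G)$: the partial Petrial $G^{\tau(A)}$ is obtained by adding a half-twist to each edge of $A$. The partial dual $G^{\delta(A)}=G^A$ is defined via arrow presentations: $G$ is represented by the boundary circles of its vertex discs carrying, for each edge $e$, two arrows labelled $e$ (on the two segments where $e$ meets vertices, directed consistently with a chosen orientation of $\partial e$); for each $e\in A$ with arrows $\alpha,\beta$, draw an arrowed segment from the head of $\alpha$ to the tail of $\beta$ and one from the head of $\beta$ to the tail of $\alpha$, label both $e$, and delete $\alpha,\beta$ and the arcs underlying them; the resulting arrow presentation determines $G^A$. The operations $\delta(A)$ and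 $\tau(A)$ generate an action of $\mathcal{B}=\langle \delta,\tau\mid \delta^2,\tau^2,(\delta\tau)^3\rangle$ on edge sets; a twisted dual of $G$ is a ribbon graph of the form $G^{\prod_{i=1}^6 \xi_i(A_i)}$ where the $A_i$ partition $E(G)$ and the $\xi_i$ are the six elements of $\mathcal{B}$. -}

module Defs where

open import Data.Nat using (ℕ)
open import Data.Fin using (Fin)
open import Data.Bool using (Bool)
open import Data.Product using (_×_; _,_; Σ; ∃; ∃-syntax; proj₁; proj₂)
open import Function using (_∘_)
open import Relation.Binary.PropositionalEquality using (_≡_; _≢_)

-- A ribbon graph (without isolated vertices) is encoded by its finite
-- set of flags Fin n together with three involutions:
--   t0 : moves a flag to the other end of its edge (same side),
--   t1 : moves a flag around its vertex to the adjacent edge,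
--   t2 : moves a flag to the other side of its edge (same end).
-- vertices = ⟨t1,t2⟩-orbits, edges = ⟨t0,t2⟩-orbits,
-- faces (boundary components) = ⟨t0,t1⟩-orbits.

record RawGem : Set where
  field
    n  : ℕ
    t0 : Fin n → Fin n
    t1 : Fin n → Fin n
    t2 : Fin n → Fin n

open RawGem public

FixedPointFreeInvolution : {m : ℕ} → (Fin m → Fin m) → Set
FixedPointFreeInvolution s = (∀ f → s (s f) ≡ f) × (∀ f → s f ≢ f)

IsGem : RawGem → Set
IsGem G =
  FixedPointFreeInvolution (t0 G) ×
  FixedPointFreeInvolution (t1 G) ×
  FixedPointFreeInvolution (t2 G) ×
  (∀ f → t0 G (t2 G f) ≡ t2 G (t0 G f)) ×
  (∀ f → t0 G (t2 G f) ≢ f)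

RibbonGraph : Set
RibbonGraph = Σ RawGem IsGem

-- Checkerboard colourings: a red/blue colouring of faces is a colouring
-- of flags constant on ⟨t0,t1⟩-orbits; the two edge line segments of the
-- edge containing flag f lie on the faces of f and of t2 f.

CheckerboardColourable : RawGem → Set
CheckerboardColourable G =
  Σ (Fin (n G) → Bool) λ c →
    (∀ f → c (t0 G f) ≡ c f) ×
    (∀ f → c (t1 G f) ≡ c f) ×
    (∀ f → c (t2 G f) ≢ c f)

-- At an edge e the three fixed-point-free involutions
-- of its four flags are t0|e, t2|e and t0 t2|e (the non-identity elements
-- of a Klein four-group).  Partial duality δ(e) swaps the roles of t0 and
-- t2 at e; partial Petriality τ(e) replaces t0 by t0 t2 at e.  t1 is
-- never changed.

data LocalInv : Set where
  I0 I2 I02 : LocalInv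

-- product in the Klein four-group (only ever used on distinct arguments)
_·_ : LocalInv → LocalInv → LocalInv
I0  · I0  = I0
I0  · I2  = I02
I0  · I02 = I2
I2  · I0  = I02
I2  · I2  = I2
I2  · I02 = I0
I02 · I0  = I2
I02 · I2  = I0
I02 · I02 = I02

-- the roles (new t0 , new t2) at an edge
Roles : Set
Roles = LocalInv × LocalInv

δ-act : Roles → Roles
δ-act (p , q) = (q , p)

τ-act : Roles → Roles
τ-act (p , q) = (p · q , q)

data 𝓑 : Set where
  ι δ τ δτ τδ δτδ : 𝓑

-- action of an element of 𝓑 on the roles at an edge; a word is applied
-- left to right, i.e. G^{δτ(A)} = (G^{δ(A)})^{τ(A)}
act : 𝓑 → Roles → Roles
act ι   r = r
act δ   r = δ-act r
act τ   r = τ-act r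
act δτ  r = τ-act (δ-act r)
act τδ  r = δ-act (τ-act r)
act δτδ r = δ-act (τ-act (δ-act r))

evalInv : (G : RawGem) → LocalInv → Fin (n G) → Fin (n G)
evalInv G I0  f = t0 G f
evalInv G I2  f = t2 G f
evalInv G I02 f = t0 G (t2 G f)

-- An assignment of an element of 𝓑 to each edge, i.e. a partition
-- E(G) = A_ι ∪ A_δ ∪ … ∪ A_δτδ (parts possibly empty): a labelling of
-- flags constant on edges (⟨t0,t2⟩-orbits).
EdgeAssignment : RawGem → Set
EdgeAssignment G =
  Σ (Fin (n G) → 𝓑) λ ξ →
    (∀ f → ξ (t0 G f) ≡ ξ f) × (∀ f → ξ (t2 G f) ≡ ξ f)

twistedDual : (G : RawGem) → EdgeAssignment G → RawGem
twistedDual G (ξ , _) = record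
  { n  = n G
  ; t0 = λ f → evalInv G (proj₁ (act (ξ f) (I0 , I2))) f
  ; t1 = t1 G
  ; t2 = λ f → evalInv G (proj₂ (act (ξ f) (I0 , I2))) f
  }

module Submission where

-- A twisted dual of G is checkerboard colourable as soon as the flags of G can
-- be coloured red and blue so that t1 preserves the colour and every edge has
-- two flags of each colour: one of t0, t2, t0 t2 then preserves the colouring
-- on the edge and the other two reverse it, and the twist at the edge is chosen
-- to make the first the new t0 and one of the others the new t2.
--
-- Such a colouring is a balanced 2-colouring of the edges of the 4-regular
-- medial graph, which exists by an argument in the spirit of Euler's.  Each
-- edge of G is split along t0 or along t2 into two pairs of flags that must
-- receive different colours, and the pairs are then contracted one at a time.
-- The invariant is that every union of connected components carries an even
-- number of colour-reversing constraints; it is what makes the last pair of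
-- each cycle consistent, and a parity count shows that one of the two
-- splittings of every edge preserves it.

open import Defs
open import Data.Nat using (ℕ; zero; suc; _+_; _*_; s≤s)
open import Data.Nat.Properties
  using (+-0-commutativeMonoid; +-comm; +-assoc; +-identityʳ; +-cancelʳ-≡; even≢odd)
open import Data.Nat.Divisibility using (_∣_; ∣⇒≤; ∣m∣n⇒∣m+n; ∣-refl; _∣0; ∣m+n∣m⇒∣n)
open import Data.Fin using (Fin; zero; suc; _<?_)
open import Data.Fin.Properties using (_≟_; <-cmp; <-asym; all?)
open import Data.Fin.Permutation using (permutation)
open import Data.Fin.Subset using (Subset)
open import Data.Fin.Subset.Properties using (anySubset?)
open import Data.Bool using (Bool; true; false; _∧_; _∨_; not; _xor_; if_then_else_)
open import Data.Bool.Properties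
  using (∧-conicalˡ; ∧-conicalʳ; ∧-zeroʳ; ∧-identityʳ; ∨-zeroʳ; ∨-identityʳ; ¬-not; xor-identityʳ)
  renaming (_≟_ to _≟ᵇ_)
open import Data.Vec using (lookup; tabulate)
open import Data.Vec.Properties using (lookup∘tabulate)
open import Data.Product using (Σ; _×_; _,_; ∃; proj₁; proj₂)
open import Data.Empty using (⊥; ⊥-elim)
open import Data.List using ([]; _∷_; allFin)
open import Data.List.Membership.Propositional using (_∈_)
open import Data.List.Membership.Propositional.Properties using (∈-allFin)
open import Data.List.Relation.Unary.Any using (here; there)
open import Function using (_∘_; case_of_)
open import Relation.Binary using (tri<; tri≈; tri>)
open import Relation.Binary.PropositionalEquality
open import Relation.Nullary using (¬_; Dec; yes; no; does; contradiction)
open import Relation.Nullary.Decidable using (dec-true; dec-false; decidable-stable; _×-dec_; ¬?)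
import Algebra.Properties.CommutativeMonoid.Sum as Summation

open Summation +-0-commutativeMonoid using (sum; sum-cong-≗; ∑-distrib-+; sum-permute; sum-replicate-zero)

⟦_⟧ : Bool → ℕ
⟦ true ⟧  = 1
⟦ false ⟧ = 0

true≢false : true ≢ false
true≢false ()

≡-from-⇔ᵇ : ∀ {x y : Bool} → (x ≡ true → y ≡ true) → (y ≡ true → x ≡ true) → x ≡ y
≡-from-⇔ᵇ {true}  {true}  _ _ = refl
≡-from-⇔ᵇ {true}  {false} i _ = sym (i refl)
≡-from-⇔ᵇ {false} {true}  _ j = j refl
≡-from-⇔ᵇ {false} {false} _ _ = refl

does-≡ : ∀ {A B : Set} (a? : Dec A) (b? : Dec B) → (A → B) → (B → A) → does a? ≡ does b?
does-≡ (yes a) (yes b) _ _ = refl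
does-≡ (yes a) (no ¬b) f _ = contradiction (f a) ¬b
does-≡ (no ¬a) (yes b) _ g = contradiction (g b) ¬a
does-≡ (no ¬a) (no ¬b) _ _ = refl

does-sound : ∀ {A : Set} (a? : Dec A) → does a? ≡ true → A
does-sound (yes a) _ = a

module _ {m : ℕ} where

  _≡ᵇ_ : Fin m → Fin m → Bool
  x ≡ᵇ y = does (x ≟ y)

  ≡ᵇ-refl : ∀ x → (x ≡ᵇ x) ≡ true
  ≡ᵇ-refl x = dec-true (x ≟ x) refl

  ≢⇒≡ᵇ-false : ∀ {x y} → x ≢ y → (x ≡ᵇ y) ≡ false
  ≢⇒≡ᵇ-false {x} {y} = dec-false (x ≟ y)

  pointMass : Fin m → ℕ → Fin m → ℕ
  pointMass x v h = if h ≡ᵇ x then v else 0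

sum-pointMass : ∀ {m} (x : Fin m) v → sum (pointMass x v) ≡ v
sum-pointMass {suc m} zero v = trans (cong (v +_) (sum-replicate-zero m)) (+-identityʳ v)
sum-pointMass {suc m} (suc x) v = trans (sum-cong-≗ shift) (sum-pointMass x v)
  where
  shift : ∀ h → pointMass (suc x) v (suc h) ≡ pointMass x v h
  shift h with h ≟ x
  ... | yes _ = refl
  ... | no _  = refl

-- Each pair {h , q h} is counted once by lower and once by upper, and q̂ swaps
-- the two counts.
involution⇒even-count : ∀ {m} (P : Fin m → Bool) (q : Fin m → Fin m) →
  (∀ h → P h ≡ true → P (q h) ≡ true) →
  (∀ h → P h ≡ true → q (q h) ≡ h) →
  (∀ h → P h ≡ true → q h ≢ h) →
  ∃ λ k → sum (⟦_⟧ ∘ P) ≡ 2 * k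
involution⇒even-count {m} P q q-closed q-involutive q-fixedPointFree =
  sum lower , (begin
    sum (⟦_⟧ ∘ P)           ≡⟨ sum-cong-≗ split ⟩
    sum (λ h → lower h + upper h) ≡⟨ ∑-distrib-+ lower upper ⟩
    sum lower + sum upper   ≡⟨ cong (sum lower +_) upper≡lower ⟩
    sum lower + sum lower   ≡⟨ cong (sum lower +_) (sym (+-identityʳ (sum lower))) ⟩
    2 * sum lower           ∎)
  where
  open ≡-Reasoning
  q̂ : Fin m → Fin m
  q̂ h = if P h then q h else h

  P∘q̂ : ∀ h → P (q̂ h) ≡ P h
  P∘q̂ h with P h in Ph
  ... | true  = q-closed h Ph
  ... | false = Ph

  q̂-involutive : ∀ h → q̂ (q̂ h) ≡ h
  q̂-involutive h with P h in Ph
  ... | false rewrite Ph = refl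
  ... | true rewrite q-closed h Ph = q-involutive h Ph

  lower upper : Fin m → ℕ
  lower h = ⟦ P h ∧ does (h <? q̂ h) ⟧
  upper h = ⟦ P h ∧ does (q̂ h <? h) ⟧

  split : ∀ h → ⟦ P h ⟧ ≡ lower h + upper h
  split h with P h in Ph
  ... | false = refl
  ... | true with <-cmp h (q h)
  ... | tri< h<qh _ _ rewrite dec-true (h <? q h) h<qh | dec-false (q h <? h) (<-asym h<qh) = refl
  ... | tri≈ _ h≡qh _ = contradiction (sym h≡qh) (q-fixedPointFree h Ph)
  ... | tri> _ _ qh<h rewrite dec-false (h <? q h) (<-asym qh<h) | dec-true (q h <? h) qh<h = refl

  upper≡lower∘q̂ : ∀ h → upper h ≡ lower (q̂ h)
  upper≡lower∘q̂ h = sym (cong₂ (λ u v → ⟦ u ∧ does (q̂ h <? v) ⟧) (P∘q̂ h) (q̂-involutive h))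

  upper≡lower : sum upper ≡ sum lower
  upper≡lower = trans (sum-cong-≗ upper≡lower∘q̂) (sym (sum-permute lower (permutation q̂ q̂ q̂-involutive q̂-involutive)))

-- ⟦ p ⟧ + ⟦ q ⟧ + 1 and ⟦ p xor q xor true ⟧ have the same parity, so the two
-- sides differ by a multiple of 4.
4∣-contraction : ∀ x y p q →
  x + ((⟦ p ⟧ + 1) + ((⟦ q ⟧ + 1) + (⟦ p ⟧ + ⟦ q ⟧))) ≡ y + (⟦ p xor q xor true ⟧ + ⟦ p xor q xor true ⟧) →
  4 ∣ y → 4 ∣ x
4∣-contraction x y false false e 4∣y = subst (4 ∣_) (sym (+-cancelʳ-≡ 2 x y e)) 4∣y
4∣-contraction x y true  false e 4∣y =
  ∣m+n∣m⇒∣n (subst (4 ∣_) (trans (sym (+-identityʳ y)) (trans (sym e) (+-comm x 4))) 4∣y) ∣-refl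
4∣-contraction x y false true  e 4∣y =
  ∣m+n∣m⇒∣n (subst (4 ∣_) (trans (sym (+-identityʳ y)) (trans (sym e) (+-comm x 4))) 4∣y) ∣-refl
4∣-contraction x y true  true  e 4∣y =
  ∣m+n∣m⇒∣n (subst (4 ∣_) (trans (sym (+-cancelʳ-≡ 2 (x + 4) y (trans (+-assoc x 4 2) e))) (+-comm x 4)) 4∣y)
            ∣-refl

xor-cancelʳ : ∀ x y → (x xor y) xor y ≡ x
xor-cancelʳ true  true  = refl
xor-cancelʳ true  false = refl
xor-cancelʳ false true  = refl
xor-cancelʳ false false = refl

xor-contraction : ∀ x p q → (x xor (p xor q xor true)) xor q ≢ x xor p
xor-contraction true  true  true  ()
xor-contraction true  true  false ()
xor-contraction true  false true  ()
xor-contraction true  false false ()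
xor-contraction false true  true  ()
xor-contraction false true  false ()
xor-contraction false false true  ()
xor-contraction false false false ()

∈-tail : ∀ {A : Set} {x y : A} {xs} → x ∈ y ∷ xs → x ≢ y → x ∈ xs
∈-tail (here x≡y) x≢y = contradiction x≡y x≢y
∈-tail (there x∈xs) _ = x∈xs

TwoOfFour : Bool → Bool → Bool → Bool → Set
TwoOfFour x y z w = ⟦ x ⟧ + ⟦ y ⟧ + ⟦ z ⟧ + ⟦ w ⟧ ≡ 2

EdgeBalanced : (G : RawGem) → (Fin (n G) → Bool) → Fin (n G) → Set
EdgeBalanced G c f = TwoOfFour (c f) (c (t0 G f)) (c (t2 G f)) (c (t0 G (t2 G f)))

module GemLaws {G : RawGem} (isG : IsGem G) where

  t0-involutive : ∀ f → t0 G (t0 G f) ≡ f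
  t0-involutive = proj₁ (proj₁ isG)

  t0-fixedPointFree : ∀ f → t0 G f ≢ f
  t0-fixedPointFree = proj₂ (proj₁ isG)

  t1-involutive : ∀ f → t1 G (t1 G f) ≡ f
  t1-involutive = proj₁ (proj₁ (proj₂ isG))

  t1-fixedPointFree : ∀ f → t1 G f ≢ f
  t1-fixedPointFree = proj₂ (proj₁ (proj₂ isG))

  t2-involutive : ∀ f → t2 G (t2 G f) ≡ f
  t2-involutive = proj₁ (proj₁ (proj₂ (proj₂ isG)))

  t2-fixedPointFree : ∀ f → t2 G f ≢ f
  t2-fixedPointFree = proj₂ (proj₁ (proj₂ (proj₂ isG)))

  t0t2-comm : ∀ f → t0 G (t2 G f) ≡ t2 G (t0 G f)
  t0t2-comm = proj₁ (proj₂ (proj₂ (proj₂ isG)))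

  t0t2-fixedPointFree : ∀ f → t0 G (t2 G f) ≢ f
  t0t2-fixedPointFree = proj₂ (proj₂ (proj₂ (proj₂ isG)))

colourAt : LocalInv → Bool → Bool → Bool → Bool
colourAt I0  y z w = y
colourAt I2  y z w = z
colourAt I02 y z w = w

-- ι, δ or τ according as t0, t2 or t0 t2 preserves the colours on the edge,
-- so that the preserving involution becomes the new t0.
edgeLabel : Bool → Bool → Bool → 𝓑
edgeLabel x y z = if does (y ≟ᵇ x) then ι else if does (z ≟ᵇ x) then δ else τ

-- The labels read off the edge from t0 f and from t2 f agree with the one read
-- off from f, and under it the new t0 preserves and the new t2 flips colours.
EdgeLabelCorrect : Bool → Bool → Bool → Bool → Set
EdgeLabelCorrect x y z w =
  edgeLabel y x w ≡ edgeLabel x y z ×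
  edgeLabel z w x ≡ edgeLabel x y z ×
  colourAt (proj₁ (act (edgeLabel x y z) (I0 , I2))) y z w ≡ x ×
  colourAt (proj₂ (act (edgeLabel x y z) (I0 , I2))) y z w ≢ x

edgeLabel-correct : ∀ x y z w → TwoOfFour x y z w → EdgeLabelCorrect x y z w
edgeLabel-correct true  true  true  true  ()
edgeLabel-correct true  true  true  false ()
edgeLabel-correct true  true  false true  ()
edgeLabel-correct true  true  false false _ = refl , refl , refl , λ ()
edgeLabel-correct true  false true  true  ()
edgeLabel-correct true  false true  false _ = refl , refl , refl , λ ()
edgeLabel-correct true  false false true  _ = refl , refl , refl , λ ()
edgeLabel-correct true  false false false ()
edgeLabel-correct false true  true  true  ()
edgeLabel-correct false true  true  false _ = refl , refl , refl , λ ()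
edgeLabel-correct false true  false true  _ = refl , refl , refl , λ ()
edgeLabel-correct false true  false false ()
edgeLabel-correct false false true  true  _ = refl , refl , refl , λ ()
edgeLabel-correct false false true  false ()
edgeLabel-correct false false false true  ()
edgeLabel-correct false false false false ()

balanced⇒checkerboard-twistedDual : (G : RawGem) → IsGem G →
  (c : Fin (n G) → Bool) → (∀ f → c (t1 G f) ≡ c f) → (∀ f → EdgeBalanced G c f) →
  Σ (EdgeAssignment G) λ ξ → CheckerboardColourable (twistedDual G ξ)
balanced⇒checkerboard-twistedDual G isG c c∘t1 balanced =
  (ξ , ξ∘t0 , ξ∘t2) , c , preserved , c∘t1 , flipped
  where
  open GemLaws isG

  ξ : Fin (n G) → 𝓑
  ξ f = edgeLabel (c f) (c (t0 G f)) (c (t2 G f))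

  correct : ∀ f → EdgeLabelCorrect (c f) (c (t0 G f)) (c (t2 G f)) (c (t0 G (t2 G f)))
  correct f = edgeLabel-correct (c f) (c (t0 G f)) (c (t2 G f)) (c (t0 G (t2 G f))) (balanced f)

  ξ∘t0 : ∀ f → ξ (t0 G f) ≡ ξ f
  ξ∘t0 f rewrite t0-involutive f | sym (t0t2-comm f) = proj₁ (correct f)

  ξ∘t2 : ∀ f → ξ (t2 G f) ≡ ξ f
  ξ∘t2 f rewrite t2-involutive f = proj₁ (proj₂ (correct f))

  c∘evalInv : ∀ M f → c (evalInv G M f) ≡ colourAt M (c (t0 G f)) (c (t2 G f)) (c (t0 G (t2 G f)))
  c∘evalInv I0  f = refl
  c∘evalInv I2  f = refl
  c∘evalInv I02 f = refl

  preserved : ∀ f → c (evalInv G (proj₁ (act (ξ f) (I0 , I2))) f) ≡ c f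
  preserved f = trans (c∘evalInv _ f) (proj₁ (proj₂ (proj₂ (correct f))))

  flipped : ∀ f → c (evalInv G (proj₂ (act (ξ f) (I0 , I2))) f) ≢ c f
  flipped f e = proj₂ (proj₂ (proj₂ (correct f))) (trans (sym (c∘evalInv _ f)) e)

module BalancedColouring (G : RawGem) (isG : IsGem G) where
  open GemLaws isG

  Flag : Set
  Flag = Fin (n G)

  T0 T1 T2 : Flag → Flag
  T0 = t0 G
  T1 = t1 G
  T2 = t2 G

  ev : LocalInv → Flag → Flag
  ev = evalInv G

  ev-involutive : ∀ M f → ev M (ev M f) ≡ f
  ev-involutive I0  f = t0-involutive f
  ev-involutive I2  f = t2-involutive f
  ev-involutive I02 f = begin
    T0 (T2 (T0 (T2 f))) ≡⟨ cong T0 (sym (t0t2-comm (T2 f))) ⟩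
    T0 (T0 (T2 (T2 f))) ≡⟨ t0-involutive _ ⟩
    T2 (T2 f)           ≡⟨ t2-involutive f ⟩
    f                   ∎
    where open ≡-Reasoning

  ev-fixedPointFree : ∀ M f → ev M f ≢ f
  ev-fixedPointFree I0  = t0-fixedPointFree
  ev-fixedPointFree I2  = t2-fixedPointFree
  ev-fixedPointFree I02 = t0t2-fixedPointFree

  data OnEdge (g h : Flag) : Set where
    at-g    : h ≡ g → OnEdge g h
    at-t0   : h ≡ T0 g → OnEdge g h
    at-t2   : h ≡ T2 g → OnEdge g h
    at-t0t2 : h ≡ T0 (T2 g) → OnEdge g h

  onEdge? : ∀ g h → Dec (OnEdge g h)
  onEdge? g h with h ≟ g | h ≟ T0 g | h ≟ T2 g | h ≟ T0 (T2 g)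
  ... | yes e | _     | _     | _     = yes (at-g e)
  ... | no _  | yes e | _     | _     = yes (at-t0 e)
  ... | no _  | no _  | yes e | _     = yes (at-t2 e)
  ... | no _  | no _  | no _  | yes e = yes (at-t0t2 e)
  ... | no ¬a | no ¬b | no ¬c | no ¬d = no λ where
    (at-g e) → ¬a e
    (at-t0 e) → ¬b e
    (at-t2 e) → ¬c e
    (at-t0t2 e) → ¬d e

  onEdge : Flag → Flag → Bool
  onEdge g h = does (onEdge? g h)

  OnEdge-t0 : ∀ {g h} → OnEdge g h → OnEdge g (T0 h)
  OnEdge-t0 (at-g refl)    = at-t0 refl
  OnEdge-t0 (at-t0 refl)   = at-g (t0-involutive _)
  OnEdge-t0 (at-t2 refl)   = at-t0t2 refl
  OnEdge-t0 (at-t0t2 refl) = at-t2 (t0-involutive _)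

  OnEdge-t2 : ∀ {g h} → OnEdge g h → OnEdge g (T2 h)
  OnEdge-t2 (at-g refl)    = at-t2 refl
  OnEdge-t2 (at-t0 refl)   = at-t0t2 (sym (t0t2-comm _))
  OnEdge-t2 (at-t2 refl)   = at-g (t2-involutive _)
  OnEdge-t2 {g} (at-t0t2 refl) = at-t0 (begin
    T2 (T0 (T2 g)) ≡⟨ sym (t0t2-comm (T2 g)) ⟩
    T0 (T2 (T2 g)) ≡⟨ cong T0 (t2-involutive g) ⟩
    T0 g           ∎)
    where open ≡-Reasoning

  OnEdge-ev : ∀ M {g h} → OnEdge g h → OnEdge g (ev M h)
  OnEdge-ev I0  = OnEdge-t0
  OnEdge-ev I2  = OnEdge-t2
  OnEdge-ev I02 = OnEdge-t0 ∘ OnEdge-t2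

  onEdge-ev : ∀ M g h → onEdge g (ev M h) ≡ onEdge g h
  onEdge-ev M g h = does-≡ (onEdge? g (ev M h)) (onEdge? g h)
    (λ e → subst (OnEdge g) (ev-involutive M h) (OnEdge-ev M e)) (OnEdge-ev M)

  onEdge-self : ∀ M g → onEdge g (ev M g) ≡ true
  onEdge-self M g = dec-true (onEdge? g (ev M g)) (OnEdge-ev M (at-g refl))

  onEdge-sound : ∀ {g h} → onEdge g h ≡ true → OnEdge g h
  onEdge-sound {g} {h} = does-sound (onEdge? g h)

  onEdge-refl : ∀ g → onEdge g g ≡ true
  onEdge-refl g = dec-true (onEdge? g g) (at-g refl)

  edge-size : ∀ g → sum (⟦_⟧ ∘ onEdge g) ≡ 4
  edge-size g = begin
    sum (⟦_⟧ ∘ onEdge g)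
      ≡⟨ sum-cong-≗ pointwise ⟩
    sum (λ h → pointMass g 1 h + (pointMass (T0 g) 1 h + (pointMass (T2 g) 1 h + pointMass (T0 (T2 g)) 1 h)))
      ≡⟨ ∑-distrib-+ (pointMass g 1) _ ⟩
    sum (pointMass g 1) + sum (λ h → pointMass (T0 g) 1 h + (pointMass (T2 g) 1 h + pointMass (T0 (T2 g)) 1 h))
      ≡⟨ cong₂ _+_ (sum-pointMass g 1) (∑-distrib-+ (pointMass (T0 g) 1) _) ⟩
    1 + (sum (pointMass (T0 g) 1) + sum (λ h → pointMass (T2 g) 1 h + pointMass (T0 (T2 g)) 1 h))
      ≡⟨ cong (λ x → 1 + x) (cong₂ _+_ (sum-pointMass (T0 g) 1) (∑-distrib-+ (pointMass (T2 g) 1) _)) ⟩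
    2 + (sum (pointMass (T2 g) 1) + sum (pointMass (T0 (T2 g)) 1))
      ≡⟨ cong (λ x → 2 + x) (cong₂ _+_ (sum-pointMass (T2 g) 1) (sum-pointMass (T0 (T2 g)) 1)) ⟩
    4 ∎
    where
    open ≡-Reasoning
    g≢t0 : g ≢ T0 g
    g≢t0 e = t0-fixedPointFree g (sym e)
    g≢t2 : g ≢ T2 g
    g≢t2 e = t2-fixedPointFree g (sym e)
    g≢t0t2 : g ≢ T0 (T2 g)
    g≢t0t2 e = t0t2-fixedPointFree g (sym e)
    t0≢t2 : T0 g ≢ T2 g
    t0≢t2 e = t0t2-fixedPointFree g (trans (cong T0 (sym e)) (t0-involutive g))
    t0≢t0t2 : T0 g ≢ T0 (T2 g)
    t0≢t0t2 e = t2-fixedPointFree g (sym (trans (sym (t0-involutive g)) (trans (cong T0 e) (t0-involutive (T2 g)))))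
    t2≢t0t2 : T2 g ≢ T0 (T2 g)
    t2≢t0t2 e = t0-fixedPointFree (T2 g) (sym e)

    pointwise : ∀ h → ⟦ onEdge g h ⟧ ≡
      pointMass g 1 h + (pointMass (T0 g) 1 h + (pointMass (T2 g) 1 h + pointMass (T0 (T2 g)) 1 h))
    pointwise h with h ≟ g | h ≟ T0 g | h ≟ T2 g | h ≟ T0 (T2 g)
    ... | yes e₁ | yes e₂ | _      | _      = contradiction (trans (sym e₁) e₂) g≢t0
    ... | yes e₁ | no _   | yes e₃ | _      = contradiction (trans (sym e₁) e₃) g≢t2
    ... | yes e₁ | no _   | no _   | yes e₄ = contradiction (trans (sym e₁) e₄) g≢t0t2
    ... | yes _  | no _   | no _   | no _   = refl
    ... | no _   | yes e₂ | yes e₃ | _      = contradiction (trans (sym e₂) e₃) t0≢t2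
    ... | no _   | yes e₂ | no _   | yes e₄ = contradiction (trans (sym e₂) e₄) t0≢t0t2
    ... | no _   | yes _  | no _   | no _   = refl
    ... | no _   | no _   | yes e₃ | yes e₄ = contradiction (trans (sym e₃) e₄) t2≢t0t2
    ... | no _   | no _   | yes _  | no _   = refl
    ... | no _   | no _   | no _   | yes _  = refl
    ... | no _   | no _   | no _   | no _   = refl

  data Kind : Set where
    unsplit : Kind
    split   : LocalInv → Kind

  split≢unsplit : ∀ {M} → split M ≢ unsplit
  split≢unsplit ()

  split-injective : ∀ {M M'} → split M ≡ split M' → M ≡ M'
  split-injective refl = refl

  splitWeight : Kind → ℕ
  splitWeight unsplit   = 0
  splitWeight (split _) = 1

  -- The reduction problem: colour the active flags so that c (partner f) is
  -- c f xor sign f, every unsplit edge is balanced, and the two flags of a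
  -- pair {f , ev M f} of an edge split along M have different colours.
  record State : Set where
    field
      active  : Flag → Bool
      partner : Flag → Flag
      sign    : Flag → Bool
      kind    : Flag → Kind
  open State

  record WellFormed (S : State) : Set where
    field
      partner-active          : ∀ f → active S f ≡ true → active S (partner S f) ≡ true
      partner-involutive      : ∀ f → active S f ≡ true → partner S (partner S f) ≡ f
      partner-fixedPointFree  : ∀ f → active S f ≡ true → partner S f ≢ f
      sign-partner            : ∀ f → active S f ≡ true → sign S (partner S f) ≡ sign S f
      kind-t0                 : ∀ f → kind S (T0 f) ≡ kind S f
      kind-t2                 : ∀ f → kind S (T2 f) ≡ kind S f
      unsplit-active          : ∀ f → active S f ≡ true → kind S f ≡ unsplit →
                                active S (T0 f) ≡ true × active S (T2 f) ≡ true
      split-active            : ∀ f M → active S f ≡ true → kind S f ≡ split M → active S (ev M f) ≡ true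

  kind-ev : ∀ {S} → WellFormed S → ∀ M f → kind S (ev M f) ≡ kind S f
  kind-ev w I0  f = WellFormed.kind-t0 w f
  kind-ev w I2  f = WellFormed.kind-t2 w f
  kind-ev w I02 f = trans (WellFormed.kind-t0 w (T2 f)) (WellFormed.kind-t2 w f)

  kind-onEdge : ∀ {S} → WellFormed S → ∀ {g h} → OnEdge g h → kind S h ≡ kind S g
  kind-onEdge w (at-g refl)    = refl
  kind-onEdge w (at-t0 refl)   = kind-ev w I0 _
  kind-onEdge w (at-t2 refl)   = kind-ev w I2 _
  kind-onEdge w (at-t0t2 refl) = kind-ev w I02 _

  unsplit-active-ev : ∀ {S} → WellFormed S → ∀ M f → active S f ≡ true → kind S f ≡ unsplit →
                      active S (ev M f) ≡ true
  unsplit-active-ev w I0  f a k = proj₁ (WellFormed.unsplit-active w f a k)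
  unsplit-active-ev w I2  f a k = proj₂ (WellFormed.unsplit-active w f a k)
  unsplit-active-ev w I02 f a k = proj₁ (WellFormed.unsplit-active w (T2 f)
    (proj₂ (WellFormed.unsplit-active w f a k)) (trans (WellFormed.kind-t2 w f) k))

  unsplit-active-onEdge : ∀ {S} → WellFormed S → ∀ {g h} → active S g ≡ true → kind S g ≡ unsplit →
                          OnEdge g h → active S h ≡ true
  unsplit-active-onEdge w a k (at-g refl)    = a
  unsplit-active-onEdge w a k (at-t0 refl)   = unsplit-active-ev w I0 _ a k
  unsplit-active-onEdge w a k (at-t2 refl)   = unsplit-active-ev w I2 _ a k
  unsplit-active-onEdge w a k (at-t0t2 refl) = unsplit-active-ev w I02 _ a k

  neighboursIn : Kind → (Flag → Bool) → Flag → Bool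
  neighboursIn unsplit   K g = K (T0 g) ∧ K (T2 g)
  neighboursIn (split M) K g = K (ev M g)

  closedAt : State → (Flag → Bool) → Flag → Bool
  closedAt S K g = if K g then active S g ∧ K (partner S g) ∧ neighboursIn (kind S g) K g else true

  -- The unions of connected components of the graph joining each active flag
  -- to its partner and to its neighbours on its edge.
  Closed : State → (Flag → Bool) → Set
  Closed S K = ∀ g → closedAt S K g ≡ true

  closed? : ∀ S K → Dec (Closed S K)
  closed? S K = all? (λ h → closedAt S K h ≟ᵇ true)

  Closed-intro : ∀ S K → (∀ h → K h ≡ true →
                   active S h ≡ true × K (partner S h) ≡ true × neighboursIn (kind S h) K h ≡ true) →
                 Closed S K
  Closed-intro S K inside h with K h in Kh
  ... | false = refl
  ... | true with inside h Kh
  ...   | a , p , nb rewrite a | p | nb = refl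

  Closed-cong : ∀ S {K K'} → (∀ h → K h ≡ K' h) → Closed S K → Closed S K'
  Closed-cong S {K} {K'} K≗K' cl h = trans (sym (closedAt-cong h)) (cl h)
    where
    closedAt-cong : ∀ h → closedAt S K h ≡ closedAt S K' h
    closedAt-cong h rewrite K≗K' h | K≗K' (partner S h) with kind S h
    ... | unsplit rewrite K≗K' (T0 h) | K≗K' (T2 h) = refl
    ... | split M rewrite K≗K' (ev M h) = refl

  neighboursIn-mono : ∀ {K K'} → (∀ x → K x ≡ true → K' x ≡ true) →
                      ∀ k h → neighboursIn k K h ≡ true → neighboursIn k K' h ≡ true
  neighboursIn-mono K⊆K' unsplit h e
    rewrite K⊆K' _ (∧-conicalˡ _ _ e) | K⊆K' _ (∧-conicalʳ _ _ e) = refl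
  neighboursIn-mono K⊆K' (split M) h e = K⊆K' _ e

  module _ (S : State) (K : Flag → Bool) (cl : Closed S K) {g : Flag} (Kg : K g ≡ true) where

    private
      unfold : (active S g ∧ K (partner S g) ∧ neighboursIn (kind S g) K g) ≡ true
      unfold with cl g
      ... | c rewrite Kg = c

    closed⇒active : active S g ≡ true
    closed⇒active = ∧-conicalˡ _ _ unfold

    closed-partner : K (partner S g) ≡ true
    closed-partner = ∧-conicalˡ _ _ (∧-conicalʳ (active S g) _ unfold)

    closed-neighbours : neighboursIn (kind S g) K g ≡ true
    closed-neighbours = ∧-conicalʳ (K (partner S g)) _ (∧-conicalʳ (active S g) _ unfold)

    closed-unsplit : kind S g ≡ unsplit → K (T0 g) ≡ true × K (T2 g) ≡ true
    closed-unsplit k = ∧-conicalˡ _ _ nb , ∧-conicalʳ _ _ nb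
      where
      nb : neighboursIn unsplit K g ≡ true
      nb = subst (λ k → neighboursIn k K g ≡ true) k closed-neighbours

    closed-split : ∀ {M} → kind S g ≡ split M → K (ev M g) ≡ true
    closed-split k = subst (λ k → neighboursIn k K g ≡ true) k closed-neighbours

  module _ {S : State} (w : WellFormed S) (K : Flag → Bool) (cl : Closed S K) where

    closed-partner-≡ : ∀ h → active S h ≡ true → K (partner S h) ≡ K h
    closed-partner-≡ h a = ≡-from-⇔ᵇ
      (λ e → subst (λ z → K z ≡ true) (WellFormed.partner-involutive w h a) (closed-partner S K cl e))
      (closed-partner S K cl)

    closed-split-≡ : ∀ h M → kind S h ≡ split M → K (ev M h) ≡ K h
    closed-split-≡ h M k = ≡-from-⇔ᵇ
      (λ e → subst (λ z → K z ≡ true) (ev-involutive M h)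
               (closed-split S K cl e (trans (kind-ev w M h) k)))
      (λ e → closed-split S K cl e k)

    closed-t0-≡ : ∀ h → kind S h ≡ unsplit → K (T0 h) ≡ K h
    closed-t0-≡ h k = ≡-from-⇔ᵇ
      (λ e → subst (λ z → K z ≡ true) (t0-involutive h)
               (proj₁ (closed-unsplit S K cl e (trans (WellFormed.kind-t0 w h) k))))
      (λ e → proj₁ (closed-unsplit S K cl e k))

  weight : State → (Flag → Bool) → Flag → ℕ
  weight S K g = if K g then ⟦ sign S g ⟧ + splitWeight (kind S g) else 0

  -- Every negative partner pair and every split pair inside a closed set is
  -- counted at both of its flags: a closed set contains an even number of them.
  ParityInvariant : State → Set
  ParityInvariant S = ∀ K → Closed S K → 4 ∣ sum (weight S K)

  KindRespected : Kind → (Flag → Bool) → Flag → Set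
  KindRespected unsplit   c f = EdgeBalanced G c f
  KindRespected (split M) c f = c (ev M f) ≢ c f

  Respects : State → (Flag → Bool) → Flag → Set
  Respects S c f = (c (partner S f) ≡ c f xor sign S f) × KindRespected (kind S f) c f

  Solution : State → Set
  Solution S = Σ (Flag → Bool) λ c → ∀ f → active S f ≡ true → Respects S c f

  edgeInvolution : Kind → LocalInv
  edgeInvolution unsplit   = I0
  edgeInvolution (split M) = M

  closed-edgeInvolution-≡ : ∀ {S} → WellFormed S → ∀ K → Closed S K → ∀ h →
                            K (ev (edgeInvolution (kind S h)) h) ≡ K h
  closed-edgeInvolution-≡ {S} w K cl h with kind S h in k
  ... | unsplit = closed-t0-≡ w K cl h k
  ... | split M = closed-split-≡ w K cl h M k

  -- An unsplit edge is split into the pairs of `along a`; `across a` joins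
  -- the two pairs.
  data Axis : Set where
    t0-axis t2-axis : Axis

  along across : Axis → LocalInv
  along t0-axis  = I0
  along t2-axis  = I2
  across t0-axis = I2
  across t2-axis = I0

  twoOfFour-t0-pairs : ∀ x z → TwoOfFour x (not x) z (not z)
  twoOfFour-t0-pairs true  true  = refl
  twoOfFour-t0-pairs true  false = refl
  twoOfFour-t0-pairs false true  = refl
  twoOfFour-t0-pairs false false = refl

  twoOfFour-t2-pairs : ∀ x y → TwoOfFour x y (not x) (not y)
  twoOfFour-t2-pairs true  true  = refl
  twoOfFour-t2-pairs true  false = refl
  twoOfFour-t2-pairs false true  = refl
  twoOfFour-t2-pairs false false = refl

  halves⇒balanced : ∀ a (c : Flag → Bool) f → c (ev (along a) f) ≢ c f →
                    c (ev (along a) (ev (across a) f)) ≢ c (ev (across a) f) → EdgeBalanced G c f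
  halves⇒balanced t0-axis c f ≢₁ ≢₂ rewrite ¬-not ≢₁ | ¬-not ≢₂ = twoOfFour-t0-pairs (c f) (c (T2 f))
  halves⇒balanced t2-axis c f ≢₁ ≢₂ rewrite t0t2-comm f | ¬-not ≢₁ | ¬-not ≢₂ =
    twoOfFour-t2-pairs (c f) (c (T0 f))

  splitEdge : State → Flag → Axis → State
  splitEdge S g a = record S { kind = λ h → if onEdge g h then split (along a) else kind S h }

  kind-splitEdge-on : ∀ S g a {h} → onEdge g h ≡ true → kind (splitEdge S g a) h ≡ split (along a)
  kind-splitEdge-on S g a on rewrite on = refl

  kind-splitEdge-off : ∀ S g a {h} → onEdge g h ≡ false → kind (splitEdge S g a) h ≡ kind S h
  kind-splitEdge-off S g a off rewrite off = refl

  -- The two halves of the split edge of g fall into different components.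
  -- Closed sets are quantified as subsets so that this is decidable.
  Separating : State → Flag → Axis → Set
  Separating S g a = Σ (Subset (n G)) λ V →
    Closed (splitEdge S g a) (lookup V) × lookup V g ≢ lookup V (ev (across a) g)

  separating? : ∀ S g a → Dec (Separating S g a)
  separating? S g a = anySubset? λ V →
    closed? (splitEdge S g a) (lookup V) ×-dec ¬? (lookup V g ≟ᵇ lookup V (ev (across a) g))

  module Splitting {S : State} (w : WellFormed S) {g : Flag}
                   (active-g : active S g ≡ true) (unsplit-g : kind S g ≡ unsplit) where

    active-onEdge : ∀ {h} → onEdge g h ≡ true → active S h ≡ true
    active-onEdge on = unsplit-active-onEdge w active-g unsplit-g (onEdge-sound on)

    unsplit-onEdge : ∀ {h} → onEdge g h ≡ true → kind S h ≡ unsplit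
    unsplit-onEdge on = trans (kind-onEdge w (onEdge-sound on)) unsplit-g

    splitEdge-wellFormed : ∀ a → WellFormed (splitEdge S g a)
    splitEdge-wellFormed a = record
      { partner-active         = WellFormed.partner-active w
      ; partner-involutive     = WellFormed.partner-involutive w
      ; partner-fixedPointFree = WellFormed.partner-fixedPointFree w
      ; sign-partner           = WellFormed.sign-partner w
      ; kind-t0                = kind-ev′ I0
      ; kind-t2                = kind-ev′ I2
      ; unsplit-active         = unsplit-active′
      ; split-active           = split-active′
      }
      where
      S′ : State
      S′ = splitEdge S g a

      kind-ev′ : ∀ M h → kind S′ (ev M h) ≡ kind S′ h
      kind-ev′ M h rewrite onEdge-ev M g h with onEdge g h
      ... | true  = refl
      ... | false = kind-ev w M h

      unsplit-active′ : ∀ h → active S h ≡ true → kind S′ h ≡ unsplit →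
                        active S (T0 h) ≡ true × active S (T2 h) ≡ true
      unsplit-active′ h ah k with onEdge g h in on
      ... | true  = contradiction k split≢unsplit
      ... | false = WellFormed.unsplit-active w h ah k

      split-active′ : ∀ h M → active S h ≡ true → kind S′ h ≡ split M → active S (ev M h) ≡ true
      split-active′ h M ah k with onEdge g h in on
      ... | true  = active-onEdge (trans (onEdge-ev M g h) on)
      ... | false = WellFormed.split-active w h M ah k

    solution-unsplitEdge : ∀ a → Solution (splitEdge S g a) → Solution S
    solution-unsplitEdge a (c , respects) = c , λ f af → proj₁ (respects f af) , kindRespected f af
      where
      kindRespected : ∀ f → active S f ≡ true → KindRespected (kind S f) c f
      kindRespected f af with onEdge g f in on
      ... | false = subst (λ k → KindRespected k c f) (kind-splitEdge-off S g a on) (proj₂ (respects f af))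
      ... | true = subst (λ k → KindRespected k c f) (sym (unsplit-onEdge on))
                     (halves⇒balanced a c f (half f on) (half f′ on′))
        where
        half : ∀ h → onEdge g h ≡ true → c (ev (along a) h) ≢ c h
        half h onh = subst (λ k → KindRespected k c h) (kind-splitEdge-on S g a onh)
                       (proj₂ (respects h (active-onEdge onh)))
        f′ : Flag
        f′ = ev (across a) f
        on′ : onEdge g f′ ≡ true
        on′ = trans (onEdge-ev (across a) g f) on

    halves-joined : ∀ a → ¬ Separating S g a → ∀ K → Closed (splitEdge S g a) K →
                    K g ≡ K (ev (across a) g)
    halves-joined a ns K cl = decidable-stable (K g ≟ᵇ K (ev (across a) g)) λ K-separates →
      ns (tabulate K , Closed-cong (splitEdge S g a) (λ h → sym (lookup∘tabulate K h)) cl ,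
          λ e → K-separates (trans (sym (lookup∘tabulate K g)) (trans e (lookup∘tabulate K _))))

    halves-≡ : ∀ a K → Closed (splitEdge S g a) K → ∀ {h} → onEdge g h ≡ true → K (ev (along a) h) ≡ K h
    halves-≡ a K cl {h} on =
      closed-split-≡ (splitEdge-wellFormed a) K cl h (along a) (kind-splitEdge-on S g a on)

    constant-onEdge : ∀ a → ¬ Separating S g a → ∀ K → Closed (splitEdge S g a) K →
                      ∀ {h} → OnEdge g h → K h ≡ K g
    constant-onEdge a       ns K cl (at-g refl)    = refl
    constant-onEdge t0-axis ns K cl (at-t0 refl)   = halves-≡ t0-axis K cl (onEdge-refl g)
    constant-onEdge t0-axis ns K cl (at-t2 refl)   = sym (halves-joined t0-axis ns K cl)
    constant-onEdge t0-axis ns K cl (at-t0t2 refl) =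
      trans (halves-≡ t0-axis K cl (onEdge-self I2 g)) (sym (halves-joined t0-axis ns K cl))
    constant-onEdge t2-axis ns K cl (at-t0 refl)   = sym (halves-joined t2-axis ns K cl)
    constant-onEdge t2-axis ns K cl (at-t2 refl)   = halves-≡ t2-axis K cl (onEdge-refl g)
    constant-onEdge t2-axis ns K cl (at-t0t2 refl) =
      trans (cong K (t0t2-comm g))
        (trans (halves-≡ t2-axis K cl (onEdge-self I0 g)) (sym (halves-joined t2-axis ns K cl)))

    -- Without separation, a closed set of the split state is closed in S and
    -- contains the edge of g entirely or not at all, so it gains weight 4 or 0.
    closed-unsplitEdge : ∀ a → ¬ Separating S g a → ∀ K → Closed (splitEdge S g a) K → Closed S K
    closed-unsplitEdge a ns K cl = Closed-intro S K λ h Kh →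
      closed⇒active S′ K cl Kh , closed-partner S′ K cl Kh , neighbours h Kh
      where
      S′ : State
      S′ = splitEdge S g a

      inside : ∀ {h} x → K h ≡ true → onEdge g h ≡ true → onEdge g x ≡ true → K x ≡ true
      inside x Kh on onx = trans (constant-onEdge a ns K cl (onEdge-sound onx))
                           (trans (sym (constant-onEdge a ns K cl (onEdge-sound on))) Kh)

      neighbours : ∀ h → K h ≡ true → neighboursIn (kind S h) K h ≡ true
      neighbours h Kh with onEdge g h in on
      ... | false = subst (λ k → neighboursIn k K h ≡ true) (kind-splitEdge-off S g a on)
                      (closed-neighbours S′ K cl Kh)
      ... | true rewrite unsplit-onEdge {h} on
                       | inside (T0 h) Kh on (trans (onEdge-ev I0 g h) on)
                       | inside (T2 h) Kh on (trans (onEdge-ev I2 g h) on) = refl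

    weight-splitEdge : ∀ a → ¬ Separating S g a → ∀ K → Closed (splitEdge S g a) K →
                       ∀ h → weight (splitEdge S g a) K h ≡ weight S K h + ⟦ K g ∧ onEdge g h ⟧
    weight-splitEdge a ns K cl h with onEdge g h in on
    ... | false rewrite ∧-zeroʳ (K g) = sym (+-identityʳ _)
    ... | true rewrite unsplit-onEdge {h} on | constant-onEdge a ns K cl (onEdge-sound {g} {h} on)
                     | ∧-identityʳ (K g)
      with K g
    ...   | true  = cong (_+ 1) (sym (+-identityʳ _))
    ...   | false = refl

    parityInvariant-splitEdge : ∀ a → ¬ Separating S g a → ParityInvariant S →
                                ParityInvariant (splitEdge S g a)
    parityInvariant-splitEdge a ns inv K cl =
      subst (4 ∣_) (sym total) (∣m∣n⇒∣m+n (inv K (closed-unsplitEdge a ns K cl)) edge-part)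
      where
      total : sum (weight (splitEdge S g a) K) ≡ sum (weight S K) + sum (λ h → ⟦ K g ∧ onEdge g h ⟧)
      total = trans (sum-cong-≗ (weight-splitEdge a ns K cl)) (∑-distrib-+ (weight S K) _)

      edge-part : 4 ∣ sum (λ h → ⟦ K g ∧ onEdge g h ⟧)
      edge-part with K g
      ... | true  = subst (4 ∣_) (sym (edge-size g)) ∣-refl
      ... | false = subst (4 ∣_) (sym (sum-replicate-zero (n G))) (4 ∣0)

    -- Q, the active flags on the side of g in both separating closed sets, is closed
    -- under partner and so has even size.  Off the edge of g both sets are also
    -- closed under the edge involutions, which pair up Q minus g: Q is odd.
    ¬both-separating : Separating S g t0-axis → Separating S g t2-axis → ⊥
    ¬both-separating (V₁ , cl₁ , sep₁) (V₂ , cl₂ , sep₂) =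
      even≢odd (proj₁ Q-even) (proj₁ R-even) (trans (sym (proj₂ Q-even)) Q-count)
      where
      L₁ L₂ : Flag → Bool
      L₁ = lookup V₁
      L₂ = lookup V₂
      w₁ : WellFormed (splitEdge S g t0-axis)
      w₁ = splitEdge-wellFormed t0-axis
      w₂ : WellFormed (splitEdge S g t2-axis)
      w₂ = splitEdge-wellFormed t2-axis

      Q : Flag → Bool
      Q h = active S h ∧ does (L₁ h ≟ᵇ L₁ g) ∧ does (L₂ h ≟ᵇ L₂ g)

      module _ {h : Flag} (q : Q h ≡ true) where
        active-Q : active S h ≡ true
        active-Q = ∧-conicalˡ _ _ q

        L₁-Q : L₁ h ≡ L₁ g
        L₁-Q = does-sound (L₁ h ≟ᵇ L₁ g) (∧-conicalˡ _ _ (∧-conicalʳ (active S h) _ q))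

        L₂-Q : L₂ h ≡ L₂ g
        L₂-Q = does-sound (L₂ h ≟ᵇ L₂ g) (∧-conicalʳ _ _ (∧-conicalʳ (active S h) _ q))

      Q-intro : ∀ {h} → active S h ≡ true → L₁ h ≡ L₁ g → L₂ h ≡ L₂ g → Q h ≡ true
      Q-intro {h} a e₁ e₂ rewrite a | dec-true (L₁ h ≟ᵇ L₁ g) e₁ | dec-true (L₂ h ≟ᵇ L₂ g) e₂ = refl

      Q-partner : ∀ h → Q h ≡ true → Q (partner S h) ≡ true
      Q-partner h q = Q-intro (WellFormed.partner-active w h (active-Q q))
        (trans (closed-partner-≡ w₁ L₁ cl₁ h (active-Q q)) (L₁-Q q))
        (trans (closed-partner-≡ w₂ L₂ cl₂ h (active-Q q)) (L₂-Q q))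

      Q-onEdge : ∀ {h} → Q h ≡ true → OnEdge g h → h ≡ g
      Q-onEdge q (at-g e)       = e
      Q-onEdge q (at-t0 refl)   = contradiction (sym (L₂-Q q)) sep₂
      Q-onEdge q (at-t2 refl)   = contradiction (sym (L₁-Q q)) sep₁
      Q-onEdge q (at-t0t2 refl) =
        contradiction (sym (trans (sym (halves-≡ t0-axis L₁ cl₁ (onEdge-self I2 g))) (L₁-Q q))) sep₁

      R : Flag → Bool
      R h = Q h ∧ not (h ≡ᵇ g)

      Q-R : ∀ {h} → R h ≡ true → Q h ≡ true
      Q-R = ∧-conicalˡ _ _

      off-R : ∀ {h} → R h ≡ true → onEdge g h ≡ false
      off-R {h} r with onEdge g h in on
      ... | false = refl
      ... | true  = contradiction (cong not (dec-true (h ≟ g) (Q-onEdge (Q-R r) (onEdge-sound on))))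
                      (λ e → true≢false (trans (sym (∧-conicalʳ (Q h) _ r)) e))

      step : Flag → Flag
      step h = ev (edgeInvolution (kind S h)) h

      step-involutive : ∀ h → step (step h) ≡ h
      step-involutive h rewrite kind-ev w (edgeInvolution (kind S h)) h = ev-involutive (edgeInvolution (kind S h)) h

      L-step : ∀ a (L : Flag → Bool) → Closed (splitEdge S g a) L →
               ∀ {h} → onEdge g h ≡ false → L (step h) ≡ L h
      L-step a L cl {h} off = subst (λ k → L (ev (edgeInvolution k) h) ≡ L h) (kind-splitEdge-off S g a off)
        (closed-edgeInvolution-≡ (splitEdge-wellFormed a) L cl h)

      active-step : ∀ h → active S h ≡ true → active S (step h) ≡ true
      active-step h a with kind S h in k
      ... | unsplit = unsplit-active-ev w I0 h a k
      ... | split M = WellFormed.split-active w h M a k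

      R-intro : ∀ {h} → Q h ≡ true → h ≢ g → R h ≡ true
      R-intro {h} q h≢g rewrite q | ≢⇒≡ᵇ-false h≢g = refl

      R-step : ∀ h → R h ≡ true → R (step h) ≡ true
      R-step h r = R-intro
        (Q-intro (active-step h (active-Q q)) (trans (L-step t0-axis L₁ cl₁ off) (L₁-Q q))
                 (trans (L-step t2-axis L₂ cl₂ off) (L₂-Q q)))
        step≢g
        where
        q : Q h ≡ true
        q = Q-R r
        off : onEdge g h ≡ false
        off = off-R r
        step≢g : step h ≢ g
        step≢g e = true≢false (trans (sym (onEdge-self (edgeInvolution (kind S h)) g)) (trans
          (cong (onEdge g) (trans (cong (ev M) (sym e)) (ev-involutive M h))) off))
          where
          M : LocalInv
          M = edgeInvolution (kind S h)

      split-count : ∀ h → ⟦ Q h ⟧ ≡ ⟦ R h ⟧ + pointMass g 1 h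
      split-count h with h ≟ g
      ... | yes refl rewrite active-g | dec-true (L₁ g ≟ᵇ L₁ g) refl | dec-true (L₂ g ≟ᵇ L₂ g) refl = refl
      ... | no _ with Q h
      ...   | true  = refl
      ...   | false = refl

      Q-even : ∃ λ k → sum (⟦_⟧ ∘ Q) ≡ 2 * k
      Q-even = involution⇒even-count Q (partner S) Q-partner
        (λ h q → WellFormed.partner-involutive w h (active-Q q))
        (λ h q → WellFormed.partner-fixedPointFree w h (active-Q q))

      R-even : ∃ λ k → sum (⟦_⟧ ∘ R) ≡ 2 * k
      R-even = involution⇒even-count R step R-step (λ h _ → step-involutive h)
        (λ h _ → ev-fixedPointFree (edgeInvolution (kind S h)) h)

      Q-count : sum (⟦_⟧ ∘ Q) ≡ suc (2 * proj₁ R-even)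
      Q-count = begin
        sum (⟦_⟧ ∘ Q)                   ≡⟨ sum-cong-≗ split-count ⟩
        sum (λ h → ⟦ R h ⟧ + pointMass g 1 h) ≡⟨ ∑-distrib-+ (⟦_⟧ ∘ R) (pointMass g 1) ⟩
        sum (⟦_⟧ ∘ R) + sum (pointMass g 1)   ≡⟨ cong₂ _+_ (proj₂ R-even) (sum-pointMass g 1) ⟩
        2 * proj₁ R-even + 1                  ≡⟨ +-comm (2 * proj₁ R-even) 1 ⟩
        suc (2 * proj₁ R-even)                ∎
        where open ≡-Reasoning

    nonSeparatingAxis : Σ Axis λ a → ¬ Separating S g a
    nonSeparatingAxis with separating? S g t0-axis | separating? S g t2-axis
    ... | no ns  | _      = t0-axis , ns
    ... | yes _  | no ns  = t2-axis , ns
    ... | yes s₁ | yes s₂ = ⊥-elim (¬both-separating s₁ s₂)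

  not-≡ᵇ⇒≢ : ∀ {x y : Flag} → not (x ≡ᵇ y) ≡ true → x ≢ y
  not-≡ᵇ⇒≢ {x} ne refl = true≢false (trans (sym ne) (cong not (≡ᵇ-refl x)))

  module RemovePair {S : State} (w : WellFormed S) {a : Flag} {M : LocalInv}
                    (active-a : active S a ≡ true) (kind-a : kind S a ≡ split M) where

    b : Flag
    b = ev M a

    b≢a : b ≢ a
    b≢a = ev-fixedPointFree M a

    ev-b : ev M b ≡ a
    ev-b = ev-involutive M a

    active-b : active S b ≡ true
    active-b = WellFormed.split-active w a M active-a kind-a

    kind-b : kind S b ≡ split M
    kind-b = trans (kind-ev w M a) kind-a

    active′ : Flag → Bool
    active′ h = active S h ∧ not (h ≡ᵇ a) ∧ not (h ≡ᵇ b)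

    module _ {h : Flag} (a′ : active′ h ≡ true) where
      active′⇒active : active S h ≡ true
      active′⇒active = ∧-conicalˡ _ _ a′

      active′⇒≢a : h ≢ a
      active′⇒≢a = not-≡ᵇ⇒≢ (∧-conicalˡ _ _ (∧-conicalʳ (active S h) _ a′))

      active′⇒≢b : h ≢ b
      active′⇒≢b = not-≡ᵇ⇒≢ (∧-conicalʳ _ _ (∧-conicalʳ (active S h) _ a′))

    active′-intro : ∀ {h} → active S h ≡ true → h ≢ a → h ≢ b → active′ h ≡ true
    active′-intro a h≢a h≢b rewrite a | ≢⇒≡ᵇ-false h≢a | ≢⇒≡ᵇ-false h≢b = refl

    unsplit⇒∉pair : ∀ {x} → kind S x ≡ unsplit → x ≢ a × x ≢ b
    unsplit⇒∉pair k = (λ { refl → split≢unsplit (trans (sym kind-a) k) })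
                    , (λ { refl → split≢unsplit (trans (sym kind-b) k) })

    ev-∉pair : ∀ {h N} → h ≢ a → h ≢ b → kind S h ≡ split N → ev N h ≢ a × ev N h ≢ b
    ev-∉pair {h} {N} h≢a h≢b k = ≢a , ≢b
      where
      same-involution : ∀ {x} → kind S x ≡ split M → ev N h ≡ x → N ≡ M
      same-involution kx e = split-injective (trans (sym (trans (kind-ev w N h) k)) (trans (cong (kind S) e) kx))
      ≢a : ev N h ≢ a
      ≢a e with same-involution kind-a e
      ... | refl = h≢b (trans (sym (ev-involutive M h)) (cong (ev M) e))
      ≢b : ev N h ≢ b
      ≢b e with same-involution kind-b e
      ... | refl = h≢a (trans (sym (ev-involutive M h)) (trans (cong (ev M) e) ev-b))

    unsplit-active′ : ∀ h → active′ h ≡ true → kind S h ≡ unsplit →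
                      active′ (T0 h) ≡ true × active′ (T2 h) ≡ true
    unsplit-active′ h a′ k =
      active′-intro (proj₁ (WellFormed.unsplit-active w h (active′⇒active a′) k)) (proj₁ ∉₀) (proj₂ ∉₀) ,
      active′-intro (proj₂ (WellFormed.unsplit-active w h (active′⇒active a′) k)) (proj₁ ∉₂) (proj₂ ∉₂)
      where
      ∉₀ : T0 h ≢ a × T0 h ≢ b
      ∉₀ = unsplit⇒∉pair (trans (WellFormed.kind-t0 w h) k)
      ∉₂ : T2 h ≢ a × T2 h ≢ b
      ∉₂ = unsplit⇒∉pair (trans (WellFormed.kind-t2 w h) k)

    split-active′ : ∀ h N → active′ h ≡ true → kind S h ≡ split N → active′ (ev N h) ≡ true
    split-active′ h N a′ k = active′-intro (WellFormed.split-active w h N (active′⇒active a′) k)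
      (proj₁ ∉) (proj₂ ∉)
      where
      ∉ : ev N h ≢ a × ev N h ≢ b
      ∉ = ev-∉pair (active′⇒≢a a′) (active′⇒≢b a′) k

    active′-in-tail : ∀ {gs} → (∀ h → active S h ≡ true → h ∈ a ∷ gs) → ∀ h → active′ h ≡ true → h ∈ gs
    active′-in-tail act h a′ = ∈-tail (act h (active′⇒active a′)) (active′⇒≢a a′)

    agree-off-pair : ∀ {c c′ : Flag → Bool} → (∀ x → x ≢ a → x ≢ b → c x ≡ c′ x) →
                     ∀ x → x ≢ a × x ≢ b → c x ≡ c′ x
    agree-off-pair c≗c′ x (x≢a , x≢b) = c≗c′ x x≢a x≢b

    kindRespected-cong : ∀ (c c′ : Flag → Bool) → (∀ x → x ≢ a → x ≢ b → c x ≡ c′ x) →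
                         ∀ h → h ≢ a → h ≢ b → KindRespected (kind S h) c′ h → KindRespected (kind S h) c h
    kindRespected-cong c c′ c≗c′ h h≢a h≢b respected with kind S h in k
    ... | unsplit rewrite c≗c′ h h≢a h≢b
                        | agree-off-pair c≗c′ (T0 h) (unsplit⇒∉pair (trans (WellFormed.kind-t0 w h) k))
                        | agree-off-pair c≗c′ (T2 h) (unsplit⇒∉pair (trans (WellFormed.kind-t2 w h) k))
                        | agree-off-pair c≗c′ (T0 (T2 h)) (unsplit⇒∉pair (trans (kind-ev w I02 h) k))
                        = respected
    ... | split N rewrite c≗c′ h h≢a h≢b
                        | agree-off-pair c≗c′ (ev N h) (ev-∉pair h≢a h≢b k) = respected

    module RemoveLoop (loop : partner S a ≡ b) where

      S′ : State
      S′ = record S { active = active′ }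

      partner-b : partner S b ≡ a
      partner-b = trans (cong (partner S) (sym loop)) (WellFormed.partner-involutive w a active-a)

      sign-b : sign S b ≡ sign S a
      sign-b = trans (cong (sign S) (sym loop)) (WellFormed.sign-partner w a active-a)

      partner-∉pair : ∀ {h} → active S h ≡ true → h ≢ a → h ≢ b → partner S h ≢ a × partner S h ≢ b
      partner-∉pair {h} ah h≢a h≢b =
        (λ e → h≢b (trans (sym (WellFormed.partner-involutive w h ah)) (trans (cong (partner S) e) loop))) ,
        (λ e → h≢a (trans (sym (WellFormed.partner-involutive w h ah)) (trans (cong (partner S) e) partner-b)))

      partner-active′ : ∀ h → active′ h ≡ true → active′ (partner S h) ≡ true
      partner-active′ h a′ = active′-intro (WellFormed.partner-active w h ah) (proj₁ ∉) (proj₂ ∉)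
        where
        ah : active S h ≡ true
        ah = active′⇒active a′
        ∉ : partner S h ≢ a × partner S h ≢ b
        ∉ = partner-∉pair ah (active′⇒≢a a′) (active′⇒≢b a′)

      wellFormed′ : WellFormed S′
      wellFormed′ = record
        { partner-active         = partner-active′
        ; partner-involutive     = λ h a′ → WellFormed.partner-involutive w h (active′⇒active a′)
        ; partner-fixedPointFree = λ h a′ → WellFormed.partner-fixedPointFree w h (active′⇒active a′)
        ; sign-partner           = λ h a′ → WellFormed.sign-partner w h (active′⇒active a′)
        ; kind-t0                = WellFormed.kind-t0 w
        ; kind-t2                = WellFormed.kind-t2 w
        ; unsplit-active         = unsplit-active′
        ; split-active           = split-active′
        }

      parityInvariant′ : ParityInvariant S → ParityInvariant S′
      parityInvariant′ inv K cl = inv K (Closed-intro S K λ h Kh →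
        active′⇒active (closed⇒active S′ K cl Kh) , closed-partner S′ K cl Kh , closed-neighbours S′ K cl Kh)

      pair : Flag → Bool
      pair h = h ≡ᵇ a ∨ h ≡ᵇ b

      pair-closed : Closed S pair
      pair-closed = Closed-intro S pair λ h → inside h (h ≟ a) (h ≟ b)
        where
        pair-a : pair a ≡ true
        pair-a rewrite ≡ᵇ-refl a = refl
        pair-b : pair b ≡ true
        pair-b rewrite ≡ᵇ-refl b = ∨-zeroʳ _
        inside : ∀ h → Dec (h ≡ a) → Dec (h ≡ b) → pair h ≡ true →
                 active S h ≡ true × pair (partner S h) ≡ true × neighboursIn (kind S h) pair h ≡ true
        inside h (yes refl) _ _ rewrite loop | kind-a = active-a , pair-b , pair-b
        inside h (no _) (yes refl) _ rewrite partner-b | kind-b | ev-b = active-b , pair-a , pair-a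
        inside h (no h≢a) (no h≢b) ph rewrite ≢⇒≡ᵇ-false h≢a | ≢⇒≡ᵇ-false h≢b = contradiction ph λ ()

      pair-weight : sum (weight S pair) ≡ (⟦ sign S a ⟧ + 1) + (⟦ sign S a ⟧ + 1)
      pair-weight = trans (sum-cong-≗ pointwise) (trans (∑-distrib-+ (pointMass a v) (pointMass b v))
                      (cong₂ _+_ (sum-pointMass a v) (sum-pointMass b v)))
        where
        v : ℕ
        v = ⟦ sign S a ⟧ + 1
        pointwise : ∀ h → weight S pair h ≡ pointMass a v h + pointMass b v h
        pointwise h with h ≟ a
        ... | yes refl rewrite kind-a | ≢⇒≡ᵇ-false (≢-sym b≢a) = sym (+-identityʳ v)
        ... | no _ with h ≟ b
        ...   | yes refl rewrite kind-b | sign-b = refl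
        ...   | no _ = refl

      -- The pair {a , b} is closed by itself, so the invariant forces its
      -- partner edge to be negative.
      sign-a : ParityInvariant S → sign S a ≡ true
      sign-a inv = from-weight (sign S a) (subst (4 ∣_) pair-weight (inv pair pair-closed))
        where
        from-weight : ∀ s → 4 ∣ (⟦ s ⟧ + 1) + (⟦ s ⟧ + 1) → s ≡ true
        from-weight true  _   = refl
        from-weight false 4∣2 with ∣⇒≤ 4∣2
        ... | s≤s (s≤s ())

      solution : ParityInvariant S → Solution S′ → Solution S
      solution inv (c′ , respects′) = c , λ f af → respectsAt f af (f ≟ a) (f ≟ b)
        where
        c : Flag → Bool
        c h = if h ≡ᵇ a then true else if h ≡ᵇ b then false else c′ h

        c-off : ∀ x → x ≢ a → x ≢ b → c x ≡ c′ x
        c-off x x≢a x≢b rewrite ≢⇒≡ᵇ-false x≢a | ≢⇒≡ᵇ-false x≢b = refl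

        c-a : c a ≡ true
        c-a rewrite ≡ᵇ-refl a = refl

        c-b : c b ≡ false
        c-b rewrite ≢⇒≡ᵇ-false b≢a | ≡ᵇ-refl b = refl

        respectsAt : ∀ f → active S f ≡ true → Dec (f ≡ a) → Dec (f ≡ b) → Respects S c f
        respectsAt f af (yes refl) _ rewrite loop | kind-a | c-a | c-b | sign-a inv = refl , λ ()
        respectsAt f af (no _) (yes refl) rewrite partner-b | kind-b | ev-b | c-a | c-b | sign-b | sign-a inv
          = refl , λ ()
        respectsAt f af (no f≢a) (no f≢b) = partner-respected ,
          kindRespected-cong c c′ c-off f f≢a f≢b (proj₂ (respects′ f a′))
          where
          a′ : active′ f ≡ true
          a′ = active′-intro af f≢a f≢b
          ∉ : partner S f ≢ a × partner S f ≢ b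
          ∉ = partner-∉pair af f≢a f≢b
          partner-respected : c (partner S f) ≡ c f xor sign S f
          partner-respected rewrite c-off (partner S f) (proj₁ ∉) (proj₂ ∉) | c-off f f≢a f≢b =
            proj₁ (respects′ f a′)

    -- The path a′ – a – b – b′ is replaced by a single partner edge a′ – b′ whose
    -- sign is the combined sign of the three edges (the middle one negative).
    module Contract (¬loop : partner S a ≢ b) where

      a′ b′ : Flag
      a′ = partner S a
      b′ = partner S b

      partner⁻¹ : ∀ {h x} → active S h ≡ true → partner S h ≡ x → h ≡ partner S x
      partner⁻¹ {h} ah e = trans (sym (WellFormed.partner-involutive w h ah)) (cong (partner S) e)

      active-a′ : active S a′ ≡ true
      active-a′ = WellFormed.partner-active w a active-a

      active-b′ : active S b′ ≡ true
      active-b′ = WellFormed.partner-active w b active-b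

      partner-a′ : partner S a′ ≡ a
      partner-a′ = WellFormed.partner-involutive w a active-a

      partner-b′ : partner S b′ ≡ b
      partner-b′ = WellFormed.partner-involutive w b active-b

      sign-a′ : sign S a′ ≡ sign S a
      sign-a′ = WellFormed.sign-partner w a active-a

      sign-b′ : sign S b′ ≡ sign S b
      sign-b′ = WellFormed.sign-partner w b active-b

      a′≢a : a′ ≢ a
      a′≢a = WellFormed.partner-fixedPointFree w a active-a

      b′≢b : b′ ≢ b
      b′≢b = WellFormed.partner-fixedPointFree w b active-b

      b′≢a : b′ ≢ a
      b′≢a e = ¬loop (sym (partner⁻¹ active-b e))

      a′≢b′ : a′ ≢ b′
      a′≢b′ e = b≢a (sym (trans (partner⁻¹ active-a e) partner-b′))

      active′-a′ : active′ a′ ≡ true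
      active′-a′ = active′-intro active-a′ a′≢a ¬loop

      active′-b′ : active′ b′ ≡ true
      active′-b′ = active′-intro active-b′ b′≢a b′≢b

      partner-∉ : ∀ {h} → active S h ≡ true → h ≢ a → h ≢ b → h ≢ a′ → h ≢ b′ →
                  partner S h ≢ a × partner S h ≢ b × partner S h ≢ a′ × partner S h ≢ b′
      partner-∉ ah h≢a h≢b h≢a′ h≢b′ =
        (λ e → h≢a′ (partner⁻¹ ah e)) ,
        (λ e → h≢b′ (partner⁻¹ ah e)) ,
        (λ e → h≢a (trans (partner⁻¹ ah e) partner-a′)) ,
        (λ e → h≢b (trans (partner⁻¹ ah e) partner-b′))

      s′ : Bool
      s′ = sign S a xor sign S b xor true

      partner′ : Flag → Flag
      partner′ h = if h ≡ᵇ a′ then b′ else if h ≡ᵇ b′ then a′ else partner S h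

      sign′ : Flag → Bool
      sign′ h = if h ≡ᵇ a′ ∨ h ≡ᵇ b′ then s′ else sign S h

      S′ : State
      S′ = record S { active = active′ ; partner = partner′ ; sign = sign′ }

      partner′-a′ : partner′ a′ ≡ b′
      partner′-a′ rewrite ≡ᵇ-refl a′ = refl

      partner′-b′ : partner′ b′ ≡ a′
      partner′-b′ rewrite ≢⇒≡ᵇ-false (≢-sym a′≢b′) | ≡ᵇ-refl b′ = refl

      partner′-off : ∀ {h} → h ≢ a′ → h ≢ b′ → partner′ h ≡ partner S h
      partner′-off h≢a′ h≢b′ rewrite ≢⇒≡ᵇ-false h≢a′ | ≢⇒≡ᵇ-false h≢b′ = refl

      sign′-a′ : sign′ a′ ≡ s′
      sign′-a′ rewrite ≡ᵇ-refl a′ = refl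

      sign′-b′ : sign′ b′ ≡ s′
      sign′-b′ rewrite ≢⇒≡ᵇ-false (≢-sym a′≢b′) | ≡ᵇ-refl b′ = refl

      sign′-off : ∀ {h} → h ≢ a′ → h ≢ b′ → sign′ h ≡ sign S h
      sign′-off h≢a′ h≢b′ rewrite ≢⇒≡ᵇ-false h≢a′ | ≢⇒≡ᵇ-false h≢b′ = refl

      by-cases : (P : Flag → Set) → P a′ → P b′ → (∀ h → h ≢ a′ → h ≢ b′ → P h) → ∀ h → P h
      by-cases P at-a′ at-b′ off h with h ≟ a′ | h ≟ b′
      ... | yes refl | _        = at-a′
      ... | no _     | yes refl = at-b′
      ... | no h≢a′  | no h≢b′  = off h h≢a′ h≢b′

      module _ {h : Flag} (a′h : active′ h ≡ true) (h≢a′ : h ≢ a′) (h≢b′ : h ≢ b′) where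
        private
          ah : active S h ≡ true
          ah = active′⇒active a′h
          ∉ : partner S h ≢ a × partner S h ≢ b × partner S h ≢ a′ × partner S h ≢ b′
          ∉ = partner-∉ ah (active′⇒≢a a′h) (active′⇒≢b a′h) h≢a′ h≢b′

        partner′-off-active : active′ (partner′ h) ≡ true
        partner′-off-active rewrite partner′-off h≢a′ h≢b′ =
          active′-intro (WellFormed.partner-active w h ah) (proj₁ ∉) (proj₁ (proj₂ ∉))

        partner′-off-involutive : partner′ (partner′ h) ≡ h
        partner′-off-involutive rewrite partner′-off h≢a′ h≢b′
                                      | partner′-off (proj₁ (proj₂ (proj₂ ∉))) (proj₂ (proj₂ (proj₂ ∉))) =
          WellFormed.partner-involutive w h ah

        sign′-off-partner : sign′ (partner′ h) ≡ sign′ h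
        sign′-off-partner rewrite partner′-off h≢a′ h≢b′
                                | sign′-off (proj₁ (proj₂ (proj₂ ∉))) (proj₂ (proj₂ (proj₂ ∉)))
                                | sign′-off h≢a′ h≢b′ =
          WellFormed.sign-partner w h ah

      wellFormed′ : WellFormed S′
      wellFormed′ = record
        { partner-active         = by-cases (λ h → active′ h ≡ true → active′ (partner′ h) ≡ true)
            (λ _ → subst (λ x → active′ x ≡ true) (sym partner′-a′) active′-b′)
            (λ _ → subst (λ x → active′ x ≡ true) (sym partner′-b′) active′-a′)
            (λ h h≢a′ h≢b′ a′h → partner′-off-active a′h h≢a′ h≢b′)
        ; partner-involutive     = by-cases (λ h → active′ h ≡ true → partner′ (partner′ h) ≡ h)
            (λ _ → trans (cong partner′ partner′-a′) partner′-b′)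
            (λ _ → trans (cong partner′ partner′-b′) partner′-a′)
            (λ h h≢a′ h≢b′ a′h → partner′-off-involutive a′h h≢a′ h≢b′)
        ; partner-fixedPointFree = by-cases (λ h → active′ h ≡ true → partner′ h ≢ h)
            (λ _ → subst (_≢ a′) (sym partner′-a′) (≢-sym a′≢b′))
            (λ _ → subst (_≢ b′) (sym partner′-b′) a′≢b′)
            (λ h h≢a′ h≢b′ a′h → subst (_≢ h) (sym (partner′-off h≢a′ h≢b′))
                                   (WellFormed.partner-fixedPointFree w h (active′⇒active a′h)))
        ; sign-partner           = by-cases (λ h → active′ h ≡ true → sign′ (partner′ h) ≡ sign′ h)
            (λ _ → trans (cong sign′ partner′-a′) (trans sign′-b′ (sym sign′-a′)))
            (λ _ → trans (cong sign′ partner′-b′) (trans sign′-a′ (sym sign′-b′)))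
            (λ h h≢a′ h≢b′ a′h → sign′-off-partner a′h h≢a′ h≢b′)
        ; kind-t0                = WellFormed.kind-t0 w
        ; kind-t2                = WellFormed.kind-t2 w
        ; unsplit-active         = unsplit-active′
        ; split-active           = split-active′
        }

      active′-a : active′ a ≡ false
      active′-a rewrite ≡ᵇ-refl a = ∧-zeroʳ (active S a)

      active′-b : active′ b ≡ false
      active′-b rewrite ≡ᵇ-refl b = trans (cong (active S b ∧_) (∧-zeroʳ _)) (∧-zeroʳ (active S b))

      closed′-inactive : ∀ K → Closed S′ K → ∀ {x} → active′ x ≡ false → K x ≡ false
      closed′-inactive K cl {x} ax with K x in Kx
      ... | true  = contradiction (trans (sym (closed⇒active S′ K cl Kx)) ax) true≢false
      ... | false = refl

      module Absorbing (K : Flag → Bool) (cl : Closed S′ K) (Ka′ : K a′ ≡ true) where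

        Kb′ : K b′ ≡ true
        Kb′ = subst (λ x → K x ≡ true) partner′-a′ (closed-partner S′ K cl Ka′)

        Ka : K a ≡ false
        Ka = closed′-inactive K cl active′-a

        Kb : K b ≡ false
        Kb = closed′-inactive K cl active′-b

        K⁺ : Flag → Bool
        K⁺ h = K h ∨ h ≡ᵇ a ∨ h ≡ᵇ b

        K⊆K⁺ : ∀ x → K x ≡ true → K⁺ x ≡ true
        K⊆K⁺ x Kx rewrite Kx = refl

        K⁺-a : K⁺ a ≡ true
        K⁺-a rewrite ≡ᵇ-refl a = ∨-zeroʳ (K a)

        K⁺-b : K⁺ b ≡ true
        K⁺-b rewrite ≡ᵇ-refl b = trans (cong (K b ∨_) (∨-zeroʳ _)) (∨-zeroʳ (K b))

        K⁺-off : ∀ {h} → h ≢ a → h ≢ b → K⁺ h ≡ K h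
        K⁺-off {h} h≢a h≢b rewrite ≢⇒≡ᵇ-false h≢a | ≢⇒≡ᵇ-false h≢b = ∨-identityʳ (K h)

        closed-K⁺ : Closed S K⁺
        closed-K⁺ = Closed-intro S K⁺ λ h → inside h (h ≟ a) (h ≟ b)
          where
          partner-K⁺ : ∀ h → K h ≡ true → K⁺ (partner S h) ≡ true
          partner-K⁺ = by-cases (λ h → K h ≡ true → K⁺ (partner S h) ≡ true)
            (λ _ → subst (λ x → K⁺ x ≡ true) (sym partner-a′) K⁺-a)
            (λ _ → subst (λ x → K⁺ x ≡ true) (sym partner-b′) K⁺-b)
            (λ h h≢a′ h≢b′ Kh → K⊆K⁺ _ (subst (λ x → K x ≡ true) (partner′-off h≢a′ h≢b′)
                                            (closed-partner S′ K cl Kh)))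

          inside : ∀ h → Dec (h ≡ a) → Dec (h ≡ b) → K⁺ h ≡ true →
                   active S h ≡ true × K⁺ (partner S h) ≡ true × neighboursIn (kind S h) K⁺ h ≡ true
          inside h (yes refl) _ _ rewrite kind-a = active-a , K⊆K⁺ a′ Ka′ , K⁺-b
          inside h (no _) (yes refl) _ rewrite kind-b | ev-b = active-b , K⊆K⁺ b′ Kb′ , K⁺-a
          inside h (no h≢a) (no h≢b) K⁺h =
            active′⇒active (closed⇒active S′ K cl Kh) , partner-K⁺ h Kh ,
            neighboursIn-mono K⊆K⁺ (kind S h) h (closed-neighbours S′ K cl Kh)
            where
            Kh : K h ≡ true
            Kh = trans (sym (K⁺-off h≢a h≢b)) K⁺h

        -- Passing from K in S′ to K⁺ in S adds the weights of a and b and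
        -- replaces the sign s′ at a′ and b′ by their old signs.
        removed added : Flag → ℕ
        removed h = pointMass a (⟦ sign S a ⟧ + 1) h + (pointMass b (⟦ sign S b ⟧ + 1) h +
                    (pointMass a′ ⟦ sign S a ⟧ h + pointMass b′ ⟦ sign S b ⟧ h))
        added h = pointMass a′ ⟦ s′ ⟧ h + pointMass b′ ⟦ s′ ⟧ h

        weight-K⁺ : ∀ h → weight S′ K h + removed h ≡ weight S K⁺ h + added h
        weight-K⁺ h = at h (h ≟ a) (h ≟ b) (h ≟ a′) (h ≟ b′)
          where
          swap : ∀ x k y → (x + k) + y ≡ (y + k) + x
          swap x k y = trans (+-assoc x k y) (trans (+-comm x (k + y)) (cong (_+ x) (+-comm k y)))

          swap₀ : ∀ x k y → (x + k) + (y + 0) ≡ (y + k) + (x + 0)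
          swap₀ x k y rewrite +-identityʳ x | +-identityʳ y = swap x k y

          at : ∀ h → Dec (h ≡ a) → Dec (h ≡ b) → Dec (h ≡ a′) → Dec (h ≡ b′) →
               weight S′ K h + removed h ≡ weight S K⁺ h + added h
          at h (yes refl) _ _ _
            rewrite Ka | ≡ᵇ-refl a | ≢⇒≡ᵇ-false (≢-sym b≢a) | ≢⇒≡ᵇ-false (≢-sym a′≢a)
                  | ≢⇒≡ᵇ-false (≢-sym b′≢a) | kind-a = refl
          at h (no _) (yes refl) _ _
            rewrite Kb | ≢⇒≡ᵇ-false b≢a | ≡ᵇ-refl b | ≢⇒≡ᵇ-false (≢-sym ¬loop)
                  | ≢⇒≡ᵇ-false (≢-sym b′≢b) | kind-b = refl
          at h (no _) (no _) (yes refl) _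
            rewrite Ka′ | ≢⇒≡ᵇ-false a′≢a | ≢⇒≡ᵇ-false ¬loop | ≡ᵇ-refl a′ | ≢⇒≡ᵇ-false a′≢b′ | sign-a′
            = swap₀ ⟦ s′ ⟧ (splitWeight (kind S a′)) ⟦ sign S a ⟧
          at h (no _) (no _) (no _) (yes refl)
            rewrite Kb′ | ≢⇒≡ᵇ-false b′≢a | ≢⇒≡ᵇ-false b′≢b | ≢⇒≡ᵇ-false (≢-sym a′≢b′) | ≡ᵇ-refl b′
                  | sign-b′
            = swap ⟦ s′ ⟧ (splitWeight (kind S b′)) ⟦ sign S b ⟧
          at h (no h≢a) (no h≢b) (no h≢a′) (no h≢b′)
            rewrite ≢⇒≡ᵇ-false h≢a | ≢⇒≡ᵇ-false h≢b | ≢⇒≡ᵇ-false h≢a′ | ≢⇒≡ᵇ-false h≢b′ with K h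
          ... | true  = refl
          ... | false = refl

        removed-total : ℕ
        removed-total = (⟦ sign S a ⟧ + 1) + ((⟦ sign S b ⟧ + 1) + (⟦ sign S a ⟧ + ⟦ sign S b ⟧))

        weight-sums : sum (weight S′ K) + removed-total ≡ sum (weight S K⁺) + (⟦ s′ ⟧ + ⟦ s′ ⟧)
        weight-sums = begin
          sum (weight S′ K) + removed-total  ≡⟨ cong (sum (weight S′ K) +_) (sym sum-removed) ⟩
          sum (weight S′ K) + sum removed    ≡⟨ sym (∑-distrib-+ (weight S′ K) removed) ⟩
          sum (λ h → weight S′ K h + removed h) ≡⟨ sum-cong-≗ weight-K⁺ ⟩
          sum (λ h → weight S K⁺ h + added h) ≡⟨ ∑-distrib-+ (weight S K⁺) added ⟩
          sum (weight S K⁺) + sum added      ≡⟨ cong (sum (weight S K⁺) +_) sum-added ⟩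
          sum (weight S K⁺) + (⟦ s′ ⟧ + ⟦ s′ ⟧) ∎
          where
          open ≡-Reasoning
          sum-removed : sum removed ≡ removed-total
          sum-removed =
            trans (∑-distrib-+ (pointMass a _) _) (cong₂ _+_ (sum-pointMass a _)
            (trans (∑-distrib-+ (pointMass b _) _) (cong₂ _+_ (sum-pointMass b _)
            (trans (∑-distrib-+ (pointMass a′ _) _) (cong₂ _+_ (sum-pointMass a′ _) (sum-pointMass b′ _))))))
          sum-added : sum added ≡ ⟦ s′ ⟧ + ⟦ s′ ⟧
          sum-added =
            trans (∑-distrib-+ (pointMass a′ _) _) (cong₂ _+_ (sum-pointMass a′ _) (sum-pointMass b′ _))

        parity : ParityInvariant S → 4 ∣ sum (weight S′ K)
        parity inv = 4∣-contraction _ _ (sign S a) (sign S b) weight-sums (inv K⁺ closed-K⁺)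

      module Avoiding (K : Flag → Bool) (cl : Closed S′ K) (Ka′ : K a′ ≡ false) where

        Kb′ : K b′ ≡ false
        Kb′ with K b′ in e
        ... | true  = contradiction
                        (trans (sym (subst (λ x → K x ≡ true) partner′-b′ (closed-partner S′ K cl e))) Ka′)
                        true≢false
        ... | false = refl

        ∉ends : ∀ {h} → K h ≡ true → h ≢ a′ × h ≢ b′
        ∉ends Kh = (λ { refl → true≢false (trans (sym Kh) Ka′) }) ,
                   (λ { refl → true≢false (trans (sym Kh) Kb′) })

        closed-K : Closed S K
        closed-K = Closed-intro S K λ h Kh →
          active′⇒active (closed⇒active S′ K cl Kh) ,
          subst (λ x → K x ≡ true) (partner′-off (proj₁ (∉ends Kh)) (proj₂ (∉ends Kh)))
            (closed-partner S′ K cl Kh) ,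
          closed-neighbours S′ K cl Kh

        same-weight : ∀ h → weight S′ K h ≡ weight S K h
        same-weight h with K h in Kh
        ... | false = refl
        ... | true rewrite sign′-off (proj₁ (∉ends Kh)) (proj₂ (∉ends Kh)) = refl

        parity : ParityInvariant S → 4 ∣ sum (weight S′ K)
        parity inv = subst (4 ∣_) (sym (sum-cong-≗ same-weight)) (inv K closed-K)

      parityInvariant′ : ParityInvariant S → ParityInvariant S′
      parityInvariant′ inv K cl with K a′ in Ka′
      ... | true  = Absorbing.parity K cl Ka′ inv
      ... | false = Avoiding.parity K cl Ka′ inv

      solution : Solution S′ → Solution S
      solution (c′ , respects′) = c , λ f af → respectsAt f af (f ≟ a) (f ≟ b) (f ≟ a′) (f ≟ b′)
        where
        c : Flag → Bool
        c h = if h ≡ᵇ a then c′ a′ xor sign S a else if h ≡ᵇ b then c′ b′ xor sign S b else c′ h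

        c-off : ∀ x → x ≢ a → x ≢ b → c x ≡ c′ x
        c-off x x≢a x≢b rewrite ≢⇒≡ᵇ-false x≢a | ≢⇒≡ᵇ-false x≢b = refl

        c-a : c a ≡ c′ a′ xor sign S a
        c-a rewrite ≡ᵇ-refl a = refl

        c-b : c b ≡ c′ b′ xor sign S b
        c-b rewrite ≢⇒≡ᵇ-false b≢a | ≡ᵇ-refl b = refl

        c′-b′ : c′ b′ ≡ c′ a′ xor s′
        c′-b′ = subst₂ (λ u v → c′ u ≡ c′ a′ xor v) partner′-a′ sign′-a′ (proj₁ (respects′ a′ active′-a′))

        c-b≢c-a : c b ≢ c a
        c-b≢c-a e = xor-contraction (c′ a′) (sign S a) (sign S b)
          (trans (sym (trans c-b (cong (_xor sign S b) c′-b′))) (trans e c-a))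

        respectsAt : ∀ f → active S f ≡ true → Dec (f ≡ a) → Dec (f ≡ b) → Dec (f ≡ a′) → Dec (f ≡ b′) →
                     Respects S c f
        respectsAt f af (yes refl) _ _ _ =
          partner-a , subst (λ k → KindRespected k c a) (sym kind-a) c-b≢c-a
          where
          partner-a : c a′ ≡ c a xor sign S a
          partner-a rewrite c-off a′ a′≢a ¬loop | c-a = sym (xor-cancelʳ (c′ a′) (sign S a))
        respectsAt f af (no _) (yes refl) _ _ =
          partner-b , subst (λ k → KindRespected k c b) (sym kind-b)
                        (subst (λ x → c x ≢ c b) (sym ev-b) (≢-sym c-b≢c-a))
          where
          partner-b : c b′ ≡ c b xor sign S b
          partner-b rewrite c-off b′ b′≢a b′≢b | c-b = sym (xor-cancelʳ (c′ b′) (sign S b))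
        respectsAt f af (no _) (no _) (yes refl) _ =
          partner-at-a′ , kindRespected-cong c c′ c-off a′ a′≢a ¬loop (proj₂ (respects′ a′ active′-a′))
          where
          partner-at-a′ : c (partner S a′) ≡ c a′ xor sign S a′
          partner-at-a′ rewrite partner-a′ | c-a | c-off a′ a′≢a ¬loop | sign-a′ = refl
        respectsAt f af (no _) (no _) (no _) (yes refl) =
          partner-at-b′ , kindRespected-cong c c′ c-off b′ b′≢a b′≢b (proj₂ (respects′ b′ active′-b′))
          where
          partner-at-b′ : c (partner S b′) ≡ c b′ xor sign S b′
          partner-at-b′ rewrite partner-b′ | c-b | c-off b′ b′≢a b′≢b | sign-b′ = refl
        respectsAt f af (no f≢a) (no f≢b) (no f≢a′) (no f≢b′) =
          partner-f , kindRespected-cong c c′ c-off f f≢a f≢b (proj₂ respected′)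
          where
          respected′ : Respects S′ c′ f
          respected′ = respects′ f (active′-intro af f≢a f≢b)
          ∉ : partner S f ≢ a × partner S f ≢ b × partner S f ≢ a′ × partner S f ≢ b′
          ∉ = partner-∉ af f≢a f≢b f≢a′ f≢b′
          partner-f : c (partner S f) ≡ c f xor sign S f
          partner-f rewrite c-off (partner S f) (proj₁ ∉) (proj₁ (proj₂ ∉)) | c-off f f≢a f≢b =
            trans (cong c′ (sym (partner′-off f≢a′ f≢b′)))
              (trans (proj₁ respected′) (cong (c′ f xor_) (sign′-off f≢a′ f≢b′)))

  AllSplit : State → Set
  AllSplit S = ∀ h → active S h ≡ true → kind S h ≢ unsplit

  solve-allSplit : ∀ gs S → WellFormed S → ParityInvariant S → AllSplit S →
                   (∀ h → active S h ≡ true → h ∈ gs) → Solution S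
  solve-allSplit [] S w inv all-split act = (λ _ → false) , λ f af → case act f af of λ ()
  solve-allSplit (g ∷ gs) S w inv all-split act with active S g in ag
  ... | false = solve-allSplit gs S w inv all-split λ h ah →
                  ∈-tail (act h ah) λ { refl → true≢false (trans (sym ah) ag) }
  ... | true with kind S g in kg
  ...   | unsplit = contradiction kg (all-split g ag)
  ...   | split M with partner S g ≟ ev M g
  ...     | yes loop = RemoveLoop.solution loop inv
                         (solve-allSplit gs S′ (RemoveLoop.wellFormed′ loop) (RemoveLoop.parityInvariant′ loop inv)
                           (λ h a′ → all-split h (active′⇒active a′)) (active′-in-tail act))
    where open RemovePair w ag kg
          open RemoveLoop loop using (S′)
  ...     | no ¬loop = Contract.solution ¬loop
                         (solve-allSplit gs S′ (Contract.wellFormed′ ¬loop) (Contract.parityInvariant′ ¬loop inv)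
                           (λ h a′ → all-split h (active′⇒active a′)) (active′-in-tail act))
    where open RemovePair w ag kg
          open Contract ¬loop using (S′)

  solve : ∀ gs S → WellFormed S → ParityInvariant S →
          (∀ h → active S h ≡ true → kind S h ≡ unsplit → h ∈ gs) → Solution S
  solve [] S w inv unsplit-in =
    solve-allSplit (allFin _) S w inv (λ h ah k → case unsplit-in h ah k of λ ()) (λ h _ → ∈-allFin h)
  solve (g ∷ gs) S w inv unsplit-in with active S g in ag | kind S g in kg
  ... | true | unsplit =
    solution-unsplitEdge a (solve gs (splitEdge S g a) (splitEdge-wellFormed a) (parityInvariant-splitEdge a ns inv)
      λ h ah k → ∈-tail (unsplit-in h ah (unsplit-off h k)) (λ { refl → g-off k }))
    where
    open Splitting w ag kg
    a : Axis
    a = proj₁ nonSeparatingAxis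
    ns : ¬ Separating S g a
    ns = proj₂ nonSeparatingAxis
    unsplit-off : ∀ h → kind (splitEdge S g a) h ≡ unsplit → kind S h ≡ unsplit
    unsplit-off h k with onEdge g h
    ... | false = k
    g-off : kind (splitEdge S g a) g ≢ unsplit
    g-off k = split≢unsplit (trans (sym (kind-splitEdge-on S g a (onEdge-refl g))) k)
  ... | true | split _ = solve gs S w inv λ h ah k →
    ∈-tail (unsplit-in h ah k) λ { refl → split≢unsplit (trans (sym kg) k) }
  ... | false | _ = solve gs S w inv λ h ah k →
    ∈-tail (unsplit-in h ah k) λ { refl → true≢false (trans (sym ah) ag) }

  initial : State
  initial = record { active = λ _ → true ; partner = T1 ; sign = λ _ → false ; kind = λ _ → unsplit }

  initial-wellFormed : WellFormed initial
  initial-wellFormed = record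
    { partner-active         = λ _ _ → refl
    ; partner-involutive     = λ f _ → t1-involutive f
    ; partner-fixedPointFree = λ f _ → t1-fixedPointFree f
    ; sign-partner           = λ _ _ → refl
    ; kind-t0                = λ _ → refl
    ; kind-t2                = λ _ → refl
    ; unsplit-active         = λ _ _ _ → refl , refl
    ; split-active           = λ _ _ _ ()
    }

  initial-parityInvariant : ParityInvariant initial
  initial-parityInvariant K _ = subst (4 ∣_) (sym (trans (sum-cong-≗ weight-zero) (sum-replicate-zero (n G)))) (4 ∣0)
    where
    weight-zero : ∀ h → weight initial K h ≡ 0
    weight-zero h with K h
    ... | true  = refl
    ... | false = refl

  balancedColouring : Σ (Flag → Bool) λ c → (∀ f → c (T1 f) ≡ c f) × (∀ f → EdgeBalanced G c f)
  balancedColouring with solve (allFin _) initial initial-wellFormed initial-parityInvariant (λ h _ _ → ∈-allFin h)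
  ... | c , respects =
    c , (λ f → trans (proj₁ (respects f refl)) (xor-identityʳ (c f))) , λ f → proj₂ (respects f refl)

theorem1 : (G : RibbonGraph) →
    Σ (EdgeAssignment (proj₁ G)) λ ξ →
      CheckerboardColourable (twistedDual (proj₁ G) ξ)
theorem1 (G , isG) with BalancedColouring.balancedColouring G isG
... | c , c∘t1 , balanced = balanced⇒checkerboard-twistedDual G isG c c∘t1 balanced
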